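{- Every colorable three-dimensional GFT graph is multi-orientable.
   Context: A three-dimensional (orientable) GFT graph is a graph with 4-valent vertices in which every edge consists of three parallel strands (left, middle, right), joined without twists. At each vertex the four half-edges are cyclically ordered, and the strands of the half-edges are joined inside the vertex following the Boulatov vertex $\phi(g_1,g_2,g_3)\phi(g_3,g_4,g_5)\phi(g_5,g_2,g_6)\phi(g_6,g_4,g_1)$: each pair of distinct half-edges at the vertex shares exactly one strand; the middle strand of a half-edge connects to the cyclically opposite half-edge and the two outer strands connect to the two cyclically adjacent half-edges. The graph may have external legs (unpaired half-edges). A GFT graph is colorable if its edges (and external legs) can be colored with four colors $0,1,2,3$ so that the four half-edges at every vertex carry four distinct colors, the graph is bipartite (the vertices split into two types, every edge joining vertices of different types), and the colors appear in a fixed cyclic order $0,1,2,3$ clockwise around vertices of the first type and anticlockwise around vertices of the second type. A GFT graph is multi-orientable if each half-edge can be labeled $+$ or $-$ so that at every vertex there are two $+$ and two $-$ half-edges alternating in the cyclic order ($+,-,+,-$), and every edge joins a $-$ half-edge to a $+$ half-edge. -}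

module Defs where

open import Data.Nat using (ℕ)
open import Data.Fin using (Fin; zero; suc)
open import Data.Bool using (Bool; true; false)
open import Data.Maybe using (Maybe; just)
open import Data.Product using (_×_; _,_; proj₁; ∃; ∃-syntax)
open import Relation.Binary.PropositionalEquality using (_≡_; _≢_)

-- Cyclic successor / predecessor on Fin 4 (positions around a vertex,
-- listed in clockwise order 0,1,2,3; also used for the colors mod 4).
next : Fin 4 → Fin 4
next zero = suc zero
next (suc zero) = suc (suc zero)
next (suc (suc zero)) = suc (suc (suc zero))
next (suc (suc (suc zero))) = zero

prev : Fin 4 → Fin 4
prev zero = suc (suc (suc zero))
prev (suc zero) = zero
prev (suc (suc zero)) = suc zero
prev (suc (suc (suc zero))) = suc (suc zero)

-- The strand routing inside a vertex is fixed by the Boulatov vertex and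
-- edges are untwisted, so the graph is fully determined by the pairing of
-- half-edges into edges; unpaired half-edges are external legs.
HalfEdge : ℕ → Set
HalfEdge n = Fin n × Fin 4

record GFTGraph : Set where
  field
    nV      : ℕ
    partner : HalfEdge nV → Maybe (HalfEdge nV)
    partner-sym  : ∀ h h' → partner h ≡ just h' → partner h' ≡ just h
    partner-irr  : ∀ h → partner h ≢ just h

open GFTGraph public

-- A coloring with colors 0..3 of half-edges (edges and external legs)
-- together with a bipartition (vertex type true = first type).
record Coloring (G : GFTGraph) : Set where
  field
    col  : HalfEdge (nV G) → Fin 4
    type : Fin (nV G) → Bool
    edge-col  : ∀ h h' → partner G h ≡ just h' → col h ≡ col h'
    edge-bip  : ∀ h h' → partner G h ≡ just h' → type (proj₁ h) ≢ type (proj₁ h')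
    distinct  : ∀ v p q → col (v , p) ≡ col (v , q) → p ≡ q
    cw        : ∀ v p → type v ≡ true  → col (v , next p) ≡ next (col (v , p))
    acw       : ∀ v p → type v ≡ false → col (v , next p) ≡ prev (col (v , p))

Colorable : GFTGraph → Set
Colorable G = Coloring G

-- Multi-orientation: sign true = '+', false = '-'.
record MultiOrientation (G : GFTGraph) : Set where
  field
    sign : HalfEdge (nV G) → Bool
    alternate : ∀ v p → sign (v , next p) ≢ sign (v , p)
    edge-opp  : ∀ h h' → partner G h ≡ just h' → sign h ≢ sign h'

MultiOrientable : GFTGraph → Set
MultiOrientable G = MultiOrientation G

module Submission where

-- Give a half-edge of colour c at a vertex of type t the sign
--   sign = parity(c) xor t,
-- where parity(c) is true for the even colours 0 and 2.  Around a vertex the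
-- colours advance by +1 (first type) or -1 (second type) from one position
-- to the next, and both moves change the parity of a colour in Z/4; the type
-- is constant at a vertex, so the signs alternate.  The two half-edges of an
-- edge carry the same colour but sit at vertices of opposite types, so their
-- signs are opposite.

open import Defs
open import Data.Fin using (Fin; zero; suc)
open import Data.Bool using (Bool; true; false; not; _xor_)
open import Data.Bool.Properties using (not-¬; ¬-not; not-distribˡ-xor; not-distribʳ-xor)
open import Data.Maybe using (just)
open import Data.Product using (_,_; proj₁)
open import Relation.Binary.PropositionalEquality
  using (_≡_; _≢_; refl; cong; sym; trans; ≢-sym; module ≡-Reasoning)

differs-from-flip : ∀ {a b : Bool} → b ≡ not a → b ≢ a
differs-from-flip b≡not-a b≡a = not-¬ refl (trans (sym b≡a) b≡not-a)

parity : Fin 4 → Bool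
parity zero                   = true
parity (suc zero)             = false
parity (suc (suc zero))       = true
parity (suc (suc (suc zero))) = false

-- Since 4 is even, stepping a colour by +1 or by -1 mod 4 flips its parity.
parity-next : ∀ c → parity (next c) ≡ not (parity c)
parity-next zero                   = refl
parity-next (suc zero)             = refl
parity-next (suc (suc zero))       = refl
parity-next (suc (suc (suc zero))) = refl

parity-prev : ∀ c → parity (prev c) ≡ not (parity c)
parity-prev zero                   = refl
parity-prev (suc zero)             = refl
parity-prev (suc (suc zero))       = refl
parity-prev (suc (suc (suc zero))) = refl

module _ {G : GFTGraph} (C : Coloring G) where
  open Coloring C

  parity-alternates : ∀ v p → parity (col (v , next p)) ≡ not (parity (col (v , p)))
  parity-alternates v p with type v in type-v
  ... | true  = trans (cong parity (cw v p type-v))  (parity-next (col (v , p)))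
  ... | false = trans (cong parity (acw v p type-v)) (parity-prev (col (v , p)))

  type-flips : ∀ h h' → partner G h ≡ just h' → type (proj₁ h') ≡ not (type (proj₁ h))
  type-flips h h' e = ¬-not (≢-sym (edge-bip h h' e))

  sign-of : HalfEdge (nV G) → Bool
  sign-of h = parity (col h) xor type (proj₁ h)

  -- Colour parity flips and the vertex type is fixed, so the sign flips.
  sign-alternates : ∀ v p → sign-of (v , next p) ≡ not (sign-of (v , p))
  sign-alternates v p = begin
    parity (col (v , next p)) xor type v     ≡⟨ cong (_xor type v) (parity-alternates v p) ⟩
    not (parity (col (v , p))) xor type v    ≡⟨ sym (not-distribˡ-xor (parity (col (v , p))) (type v)) ⟩
    not (parity (col (v , p)) xor type v)    ∎
    where open ≡-Reasoning

  -- Colour is fixed and the vertex type flips along an edge, so the sign flips.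
  sign-flips-along-edge : ∀ h h' → partner G h ≡ just h' → sign-of h' ≡ not (sign-of h)
  sign-flips-along-edge h h' e = begin
    parity (col h') xor type (proj₁ h')          ≡⟨ cong (λ c → parity c xor type (proj₁ h')) (sym (edge-col h h' e)) ⟩
    parity (col h) xor type (proj₁ h')           ≡⟨ cong (parity (col h) xor_) (type-flips h h' e) ⟩
    parity (col h) xor not (type (proj₁ h))      ≡⟨ sym (not-distribʳ-xor (parity (col h)) (type (proj₁ h))) ⟩
    not (parity (col h) xor type (proj₁ h))      ∎
    where open ≡-Reasoning

proposition3p1 : (G : GFTGraph) → Colorable G → MultiOrientable G
proposition3p1 G C = record
  { sign      = sign-of C
  ; alternate = λ v p → differs-from-flip (sign-alternates C v p)
  ; edge-opp  = λ h h' e → ≢-sym (differs-from-flip (sign-flips-along-edge C h h' e))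
  }
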